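{- Let $S$ be a join-semilattice. Then: (i) every open subset of $S$ is a set-theoretical union of set differences of ideals of $S$, hence a union of clopen subsets of $S$; (ii) $\operatorname{Reg}S$ is generated, as a complete ortholattice, by the set of all ideals of $S$; (iii) $\operatorname{Reg}S$ is the Dedekind–MacNeille completion of $\operatorname{Clop}S$; (iv) every completely join-irreducible element of $\operatorname{Reg}S$ is clopen; (v) $\operatorname{Clop}S$ is tight in $\operatorname{Reg}S$.
   Context: On a join-semilattice $S$, let $\varphi(\boldsymbol{x})$ be the set of joins of nonempty finite subsets of $\boldsymbol{x}$, and $\check\varphi(\boldsymbol{x})=S\setminus\varphi(S\setminus\boldsymbol{x})$. Closed: $\varphi(\boldsymbol{x})=\boldsymbol{x}$; open: $\check\varphi(\boldsymbol{x})=\boldsymbol{x}$; clopen: both; regular closed: $\boldsymbol{x}=\varphi\check\varphi(\boldsymbol{x})$. $\operatorname{Reg}S$ is the complete lattice of regular closed sets under inclusion (joins $\varphi(\bigcup)$, meets $\varphi\check\varphi(\bigcap)$), with orthocomplementation $\boldsymbol{x}\mapsto\varphi(S\setminus\boldsymbol{x})$; $\operatorname{Clop}S$ is the subposet of clopen sets. Ideals are (possibly empty) lower subsets closed under finite joins. An element $p$ of a lattice is completely join-irreducible if it has a unique lower cover $p_*$ and every $y<p$ satisfies $y\le p_*$. A complete lattice $L$ is the Dedekind–MacNeille completion of $K\subseteq L$ iff every element of $L$ is both a join and a meet of elements of $K$. A subset $K$ of a poset $L$ is tight in $L$ if every join (resp. meet) of a subset $X\subseteq K$ that exists in $K$ is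 also the join (resp. meet) of $X$ in $L$. -}

module Defs where

open import Level using (Level; _⊔_; suc)
open import Data.Product using (Σ; _×_; _,_)
open import Data.List.NonEmpty using (List⁺; toList; foldr₁)
open import Data.List.Relation.Unary.All using (All)
open import Relation.Nullary using (¬_)
open import Relation.Unary using (Pred; _⊆_; _⊂_; _≐_; ∁; _∖_)
open import Relation.Binary.Lattice.Bundles using (JoinSemilattice)

module _ {c ℓ₁ ℓ₂ : Level} (S : JoinSemilattice c ℓ₁ ℓ₂) where

  open JoinSemilattice S

  Lv : Level
  Lv = c ⊔ ℓ₁ ⊔ ℓ₂

  Subset : Set (suc Lv)
  Subset = Pred Carrier Lv

  record Family : Set (suc Lv) where
    constructor fam
    field
      Idx : Set Lv
      mem : Idx → Subset
  open Family public

  ⋃ : Family → Subset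
  ⋃ F a = Σ (Idx F) λ i → mem F i a

  ⋂ : Family → Subset
  ⋂ F a = (i : Idx F) → mem F i a

  φ : Subset → Subset
  φ x a = Σ (List⁺ Carrier) λ xs → All x (toList xs) × (foldr₁ _∨_ xs ≈ a)

  φ̌ : Subset → Subset
  φ̌ x = ∁ (φ (∁ x))

  Closed : Subset → Set Lv
  Closed x = φ x ≐ x

  Open : Subset → Set Lv
  Open x = φ̌ x ≐ x

  Clopen : Subset → Set Lv
  Clopen x = Closed x × Open x

  RegClosed : Subset → Set Lv
  RegClosed x = x ≐ φ (φ̌ x)

  RegJoin : Family → Subset
  RegJoin F = φ (⋃ F)

  RegMeet : Family → Subset
  RegMeet F = φ (φ̌ (⋂ F))

  Orth : Subset → Subset
  Orth x = φ (∁ x)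

  -- Ideals: (possibly empty) lower subsets closed under (binary, hence
  -- nonempty finite) joins.
  Ideal : Subset → Set Lv
  Ideal x = (∀ {a b} → b ≤ a → x a → x b)
          × (∀ {a b} → x a → x b → x (a ∨ b))

  data Gen : Subset → Set (suc Lv) where
    gen-ideal : ∀ {x} → Ideal x → Gen x
    gen-orth  : ∀ {x} → Gen x → Gen (Orth x)
    gen-join  : (F : Family) → ((i : Idx F) → Gen (mem F i)) → Gen (RegJoin F)
    gen-meet  : (F : Family) → ((i : Idx F) → Gen (mem F i)) → Gen (RegMeet F)

  IsLowerCoverInReg : Subset → Subset → Set (suc Lv)
  IsLowerCoverInReg q p =
    RegClosed q × q ⊂ p × (∀ z → RegClosed z → q ⊂ z → ¬ (z ⊂ p))

  CompletelyJoinIrreducibleInReg : Subset → Set (suc Lv)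
  CompletelyJoinIrreducibleInReg p =
    RegClosed p ×
    Σ Subset λ p* →
      IsLowerCoverInReg p* p
      × (∀ r → IsLowerCoverInReg r p → r ≐ p*)
      × (∀ y → RegClosed y → y ⊂ p → y ⊆ p*)

  IsJoinIn : (Subset → Set Lv) → Family → Subset → Set (suc Lv)
  IsJoinIn P F x = P x × (∀ i → mem F i ⊆ x)
                   × (∀ u → P u → (∀ i → mem F i ⊆ u) → x ⊆ u)

  IsMeetIn : (Subset → Set Lv) → Family → Subset → Set (suc Lv)
  IsMeetIn P F x = P x × (∀ i → x ⊆ mem F i)
                   × (∀ u → P u → (∀ i → u ⊆ mem F i) → u ⊆ x)

  AllClopen : Family → Set Lv
  AllClopen F = ∀ i → Clopen (mem F i)

module Submission where

-- The φ-closed sets are exactly the join-closed subsets, and (classically)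
-- the open ones are those with join-closed complement.  The key observation
-- is that a set x with join-closed complement is the union, over a ∈ x, of
-- the clopen differences of ideals ↓a ∖ ↓(↓a ∖ x).  Applied to φ̌ x and to
-- ∁ x for regular closed x, this writes x both as a join and as a meet in
-- Reg S of clopen sets, the former with each clopen piece a meet of an ideal
-- and the orthocomplement of an ideal.  Density of Clop S from both sides
-- gives tightness, and a completely join-irreducible x must equal one of
-- its clopen joinands.

open import Defs
open import Level using (Level; Lift; lift)
open import Axiom.DoubleNegationElimination using (em⇒dne)
open import Axiom.ExcludedMiddle using (ExcludedMiddle)
open import Data.Bool using (Bool; true; false)
open import Data.Empty using (⊥-elim)
open import Data.List using ([]; _∷_)
open import Data.List.NonEmpty using (_∷_; toList; foldr₁; _⁺++⁺_)
open import Data.List.Relation.Unary.All using (All; []; _∷_)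
import Data.List.Relation.Unary.All as All
open import Data.List.Relation.Unary.All.Properties using (++⁺)
open import Data.Product using (Σ; _×_; _,_; proj₁; proj₂)
open import Relation.Binary.Definitions using (_Respects_)
open import Relation.Binary.Lattice.Bundles using (JoinSemilattice)
import Relation.Binary.Lattice.Properties.JoinSemilattice as JoinSemilatticeProperties
open import Relation.Nullary using (¬_; yes; no)
open import Relation.Unary using (_≐_; _∖_; _⊆_; ∁)
open import Relation.Unary.Properties using (≐-sym; ≐-trans)

module φ-Closure {c ℓ₁ ℓ₂ : Level} (S : JoinSemilattice c ℓ₁ ℓ₂) where

  open JoinSemilattice S
  open JoinSemilatticeProperties S using (∨-cong; ∨-assoc; ∨-monotonic)

  JoinClosed : Subset S → Set (Lv S)
  JoinClosed x = x Respects _≈_ × (∀ {a b} → x a → x b → x (a ∨ b))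

  foldr₁-⁺++⁺ : ∀ x xs ys → foldr₁ _∨_ ((x ∷ xs) ⁺++⁺ ys) ≈ foldr₁ _∨_ (x ∷ xs) ∨ foldr₁ _∨_ ys
  foldr₁-⁺++⁺ x []      ys = Eq.refl
  foldr₁-⁺++⁺ x (z ∷ r) ys =
    Eq.trans (∨-cong Eq.refl (foldr₁-⁺++⁺ z r ys)) (Eq.sym (∨-assoc _ _ _))

  foldr₁-closed : ∀ {x} → JoinClosed x → ∀ xs → All x (toList xs) → x (foldr₁ _∨_ xs)
  foldr₁-closed x-closed (a ∷ [])    (xa ∷ [])  = xa
  foldr₁-closed x-closed (a ∷ b ∷ r) (xa ∷ xbr) = proj₂ x-closed xa (foldr₁-closed x-closed (b ∷ r) xbr)

  φ-inflationary : ∀ {x} → x ⊆ φ S x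
  φ-inflationary xa = _ ∷ [] , xa ∷ [] , Eq.refl

  φ-monotone : ∀ {x y} → x ⊆ y → φ S x ⊆ φ S y
  φ-monotone x⊆y (xs , all , eq) = xs , All.map x⊆y all , eq

  φ-cong : ∀ {x y} → x ≐ y → φ S x ≐ φ S y
  φ-cong (x⊆y , y⊆x) = φ-monotone x⊆y , φ-monotone y⊆x

  φ-joinClosed : ∀ {x} → JoinClosed (φ S x)
  φ-joinClosed =
    (λ a≈b (xs , all , eq) → xs , all , Eq.trans eq a≈b) ,
    (λ (x ∷ xs , xs∈x , eq) (ys , ys∈x , eq′) →
       (x ∷ xs) ⁺++⁺ ys , ++⁺ xs∈x ys∈x ,
       Eq.trans (foldr₁-⁺++⁺ x xs ys) (∨-cong eq eq′))

  φ-least : ∀ {x y} → JoinClosed y → x ⊆ y → φ S x ⊆ y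
  φ-least y-closed x⊆y (xs , all , eq) =
    proj₁ y-closed eq (foldr₁-closed y-closed xs (All.map x⊆y all))

  joinClosed-cong : ∀ {x y} → x ≐ y → JoinClosed x → JoinClosed y
  joinClosed-cong (x⊆y , y⊆x) (resp , join) =
    (λ a≈b ya → x⊆y (resp a≈b (y⊆x ya))) , (λ ya yb → x⊆y (join (y⊆x ya) (y⊆x yb)))

  joinClosed⇒closed : ∀ {x} → JoinClosed x → Closed S x
  joinClosed⇒closed x-closed = φ-least x-closed (λ xa → xa) , φ-inflationary

  closed⇒joinClosed : ∀ {x} → Closed S x → JoinClosed x
  closed⇒joinClosed x-closed = joinClosed-cong x-closed φ-joinClosed

  regClosed⇒joinClosed : ∀ {x} → RegClosed S x → JoinClosed x
  regClosed⇒joinClosed x-reg = joinClosed-cong (≐-sym x-reg) φ-joinClosed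

  clopen⇒regClosed : ∀ {x} → Clopen S x → RegClosed S x
  clopen⇒regClosed (x-closed , x-open) = ≐-sym (≐-trans (φ-cong x-open) x-closed)

  ∁-cong : ∀ {x y : Subset S} → x ≐ y → ∁ x ≐ ∁ y
  ∁-cong (x⊆y , y⊆x) = (λ x∌a ya → x∌a (y⊆x ya)) , (λ y∌a xa → y∌a (x⊆y xa))

  φ̌-monotone : ∀ {x y} → x ⊆ y → φ̌ S x ⊆ φ̌ S y
  φ̌-monotone x⊆y a∉φ∁x a∈φ∁y = a∉φ∁x (φ-monotone (λ y∌b xb → y∌b (x⊆y xb)) a∈φ∁y)

  φ̌-cong : ∀ {x y} → x ≐ y → φ̌ S x ≐ φ̌ S y
  φ̌-cong (x⊆y , y⊆x) = φ̌-monotone x⊆y , φ̌-monotone y⊆x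

  ∁∁-joinClosed : ∀ {x} → JoinClosed x → JoinClosed (∁ (∁ x))
  ∁∁-joinClosed (resp , join) =
    (λ a≈b ¬¬xa x∌b → ¬¬xa (λ xa → x∌b (resp a≈b xa))) ,
    (λ ¬¬xa ¬¬xb x∌a∨b → ¬¬xa (λ xa → ¬¬xb (λ xb → x∌a∨b (join xa xb))))

  ∁φ̌-joinClosed : ∀ {x} → JoinClosed (∁ (φ̌ S x))
  ∁φ̌-joinClosed = ∁∁-joinClosed φ-joinClosed

  open⇒∁-joinClosed : ∀ {x} → Open S x → JoinClosed (∁ x)
  open⇒∁-joinClosed x-open = joinClosed-cong (∁-cong x-open) ∁φ̌-joinClosed

  ideal⇒∁-joinClosed : ∀ {x} → Ideal S x → JoinClosed (∁ x)
  ideal⇒∁-joinClosed (lower , _) =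
    (λ a≈b x∌a xb → x∌a (lower (reflexive a≈b) xb)) ,
    (λ x∌a _ xa∨b → x∌a (lower (x≤x∨y _ _) xa∨b))

  ∖-joinClosed : ∀ {x y} → Ideal S x → Ideal S y → JoinClosed (x ∖ y)
  ∖-joinClosed {x} {y} (x-lower , x-join) (y-lower , _) = resp , join
    where
    resp : (x ∖ y) Respects _≈_
    resp a≈b (xa , y∌a) = x-lower (reflexive (Eq.sym a≈b)) xa , (λ yb → y∌a (y-lower (reflexive a≈b) yb))

    join : ∀ {a b} → (x ∖ y) a → (x ∖ y) b → (x ∖ y) (a ∨ b)
    join (xa , y∌a) (xb , _) = x-join xa xb , (λ ya∨b → y∌a (y-lower (x≤x∨y _ _) ya∨b))

  ⋃-cong : ∀ {I} {f g : I → Subset S} → (∀ i → f i ≐ g i) → ⋃ S (fam I f) ≐ ⋃ S (fam I g)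
  ⋃-cong f≐g = (λ (i , fia) → i , proj₁ (f≐g i) fia) , (λ (i , gia) → i , proj₂ (f≐g i) gia)

  differences : (I : Set (Lv S)) → (I → Subset S) → (I → Subset S) → Family S
  differences I upper lower = fam I (λ i → upper i ∖ lower i)

  pair : Subset S → Subset S → Family S
  pair x y = fam (Lift (Lv S) Bool) λ { (lift true) → x ; (lift false) → y }

  ∖-≐-⋂-pair : ∀ {x y} → Ideal S y → x ∖ y ≐ ⋂ S (pair x (Orth S y))
  ∖-≐-⋂-pair y-ideal =
    (λ { (xa , y∌a) (lift true) → xa ; (xa , y∌a) (lift false) → φ-inflationary y∌a }) ,
    (λ a∈⋂ → a∈⋂ (lift true) , φ-least (ideal⇒∁-joinClosed y-ideal) (λ y∌a → y∌a) (a∈⋂ (lift false)))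

  ⊆-regJoin : ∀ F i → mem F i ⊆ RegJoin S F
  ⊆-regJoin F i Fia = φ-inflationary (i , Fia)

  regJoin-least : ∀ {F u} → Closed S u → (∀ i → mem F i ⊆ u) → RegJoin S F ⊆ u
  regJoin-least u-closed F⊆u = φ-least (closed⇒joinClosed u-closed) (λ (i , Fia) → F⊆u i Fia)

  module Classical (em : ExcludedMiddle (Lv S)) where

    private
      dne : {P : Set (Lv S)} → ¬ ¬ P → P
      dne = em⇒dne em

    φ̌-deflationary : ∀ {x} → φ̌ S x ⊆ x
    φ̌-deflationary a∈φ̌x = dne (λ x∌a → a∈φ̌x (φ-inflationary x∌a))

    ∁∁-≐ : ∀ {x : Subset S} → ∁ (∁ x) ≐ x
    ∁∁-≐ = dne , (λ xa x∌a → x∌a xa)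

    ∁-joinClosed⇒open : ∀ {x} → JoinClosed (∁ x) → Open S x
    ∁-joinClosed⇒open ∁x-closed = φ̌-deflationary , (λ xa a∈φ∁x → φ-least ∁x-closed (λ x∌a → x∌a) a∈φ∁x xa)

    clopen-cong : ∀ {x y} → x ≐ y → Clopen S x → Clopen S y
    clopen-cong x≐y (x-closed , x-open) =
      ≐-trans (≐-trans (φ-cong (≐-sym x≐y)) x-closed) x≐y ,
      ≐-trans (≐-trans (φ̌-cong (≐-sym x≐y)) x-open) x≐y

    clopen-∁ : ∀ {x} → Clopen S x → Clopen S (∁ x)
    clopen-∁ (x-closed , x-open) =
      joinClosed⇒closed (open⇒∁-joinClosed x-open) ,
      ∁-joinClosed⇒open (joinClosed-cong (≐-sym ∁∁-≐) (closed⇒joinClosed x-closed))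

    ∖-clopen : ∀ {x y} → Ideal S x → Ideal S y → Clopen S (x ∖ y)
    ∖-clopen {x} {y} x-ideal@(x-lower , _) y-ideal@(_ , y-join) =
      joinClosed⇒closed (∖-joinClosed x-ideal y-ideal) , ∁-joinClosed⇒open (resp , join)
      where
      resp : ∁ (x ∖ y) Respects _≈_
      resp a≈b a∉x∖y b∈x∖y = a∉x∖y (proj₁ (∖-joinClosed x-ideal y-ideal) (Eq.sym a≈b) b∈x∖y)

      join : ∀ {a b} → ∁ (x ∖ y) a → ∁ (x ∖ y) b → ∁ (x ∖ y) (a ∨ b)
      join a∉x∖y b∉x∖y (xa∨b , y∌a∨b) =
        y∌a∨b (y-join (dne (λ y∌a → a∉x∖y (x-lower (x≤x∨y _ _) xa∨b , y∌a)))
                      (dne (λ y∌b → b∉x∖y (x-lower (y≤x∨y _ _) xa∨b , y∌b))))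

    record IdealDifferenceCover (x : Subset S) : Set (Level.suc (Lv S)) where
      field
        Index : Set (Lv S)
        upper lower : Index → Subset S
        ideals : ∀ i → Ideal S (upper i) × Ideal S (lower i)
        covers : x ≐ ⋃ S (differences Index upper lower)

      differences-clopen : AllClopen S (differences Index upper lower)
      differences-clopen i = ∖-clopen (proj₁ (ideals i)) (proj₂ (ideals i))

    -- x is covered by the pieces ↓a ∖ ↓(↓a ∖ x), a ∈ x; the subtracted set
    -- is an ideal because ↓a ∖ x is join-closed.
    ∁-joinClosed⇒idealDifferenceCover : ∀ {x} → JoinClosed (∁ x) → IdealDifferenceCover x
    ∁-joinClosed⇒idealDifferenceCover {x} (∁x-resp , ∁x-join) = record
      { Index = Σ Carrier x
      ; upper = upper
      ; lower = lower
      ; ideals = λ i → upper-ideal i , lower-ideal i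
      ; covers = x⊆⋃ , ⋃⊆x
      }
      where
      upper lower : Σ Carrier x → Subset S
      upper (a , _) b = Lift (Lv S) (b ≤ a)
      lower (a , _) b = Σ Carrier λ d → d ≤ a × ¬ x d × b ≤ d

      upper-ideal : ∀ i → Ideal S (upper i)
      upper-ideal _ = (λ b≤a (lift a≤i) → lift (trans b≤a a≤i)) , (λ (lift a≤i) (lift b≤i) → lift (∨-least a≤i b≤i))

      lower-ideal : ∀ i → Ideal S (lower i)
      lower-ideal _ =
        (λ b≤a (d , d≤i , x∌d , a≤d) → d , d≤i , x∌d , trans b≤a a≤d) ,
        (λ (d , d≤i , x∌d , a≤d) (e , e≤i , x∌e , b≤e) →
           d ∨ e , ∨-least d≤i e≤i , ∁x-join x∌d x∌e , ∨-monotonic a≤d b≤e)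

      x⊆⋃ : x ⊆ ⋃ S (differences (Σ Carrier x) upper lower)
      x⊆⋃ {a} xa = (a , xa) , lift refl ,
        λ (d , d≤a , x∌d , a≤d) → ∁x-resp (antisym d≤a a≤d) x∌d xa

      ⋃⊆x : ⋃ S (differences (Σ Carrier x) upper lower) ⊆ x
      ⋃⊆x {b} (_ , lift b≤a , b∉lower) = dne (λ x∌b → b∉lower (b , b≤a , x∌b , refl))

    ∁-joinClosed⇒⋃-clopen : ∀ {x} → JoinClosed (∁ x) → Σ (Family S) λ F → AllClopen S F × (x ≐ ⋃ S F)
    ∁-joinClosed⇒⋃-clopen ∁x-closed =
      let open IdealDifferenceCover (∁-joinClosed⇒idealDifferenceCover ∁x-closed)
      in differences Index upper lower , differences-clopen , covers

    joinClosed⇒⋂-clopen : ∀ {x} → JoinClosed x → Σ (Family S) λ G → AllClopen S G × (x ≐ ⋂ S G)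
    joinClosed⇒⋂-clopen x-closed
      with ∁-joinClosed⇒⋃-clopen (joinClosed-cong (≐-sym ∁∁-≐) x-closed)
    ... | fam I f , f-clopen , (∁x⊆⋃ , ⋃⊆∁x) =
      fam I (λ i → ∁ (f i)) , (λ i → clopen-∁ (f-clopen i)) ,
      (λ xa i fia → ⋃⊆∁x (i , fia) xa) ,
      (λ a∈⋂ → dne (λ x∌a → let (i , fia) = ∁x⊆⋃ x∌a in a∈⋂ i fia))

    regMeet-lowerBound : ∀ {G} → (∀ j → Closed S (mem G j)) → ∀ j → RegMeet S G ⊆ mem G j
    regMeet-lowerBound G-closed j =
      φ-least (closed⇒joinClosed (G-closed j)) (λ a∈φ̌⋂G → φ̌-deflationary a∈φ̌⋂G j)

    open-⊆-regMeet : ∀ {G x} → Open S x → (∀ j → x ⊆ mem G j) → x ⊆ RegMeet S G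
    open-⊆-regMeet x-open x⊆G xa =
      φ-inflationary (φ̌-monotone (λ xb j → x⊆G j xb) (proj₂ x-open xa))

    regClosed⇒regJoin-clopen : ∀ {x} → RegClosed S x → Σ (Family S) λ F → AllClopen S F × (x ≐ RegJoin S F)
    regClosed⇒regJoin-clopen x-reg with ∁-joinClosed⇒⋃-clopen ∁φ̌-joinClosed
    ... | F , F-clopen , φ̌x≐⋃F = F , F-clopen , ≐-trans x-reg (φ-cong φ̌x≐⋃F)

    regClosed⇒regMeet-clopen : ∀ {x} → RegClosed S x → Σ (Family S) λ G → AllClopen S G × (x ≐ RegMeet S G)
    regClosed⇒regMeet-clopen x-reg with joinClosed⇒⋂-clopen (regClosed⇒joinClosed x-reg)
    ... | G , G-clopen , x≐⋂G = G , G-clopen , ≐-trans x-reg (φ-cong (φ̌-cong x≐⋂G))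

    ∖-≐-regMeet : ∀ {x y} → Ideal S x → Ideal S y → x ∖ y ≐ RegMeet S (pair x (Orth S y))
    ∖-≐-regMeet x-ideal y-ideal =
      ≐-trans (clopen⇒regClosed (∖-clopen x-ideal y-ideal)) (φ-cong (φ̌-cong (∖-≐-⋂-pair y-ideal)))

    open⇒idealDifferenceCover : ∀ {x} → Open S x → IdealDifferenceCover x
    open⇒idealDifferenceCover x-open = ∁-joinClosed⇒idealDifferenceCover (open⇒∁-joinClosed x-open)

    regClosed⇒generated : ∀ {x} → RegClosed S x → Σ (Subset S) λ y → Gen S y × (y ≐ x)
    regClosed⇒generated {x} x-reg =
      RegJoin S pieces , gen-join pieces piece-generated ,
      ≐-sym (≐-trans x-reg (φ-cong (≐-trans covers (⋃-cong λ i → ∖-≐-regMeet (upper-ideal i) (lower-ideal i)))))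
      where
      open IdealDifferenceCover (∁-joinClosed⇒idealDifferenceCover (∁φ̌-joinClosed {x}))

      upper-ideal : ∀ i → Ideal S (upper i)
      upper-ideal i = proj₁ (ideals i)

      lower-ideal : ∀ i → Ideal S (lower i)
      lower-ideal i = proj₂ (ideals i)

      pieces : Family S
      pieces = fam Index λ i → RegMeet S (pair (upper i) (Orth S (lower i)))

      piece-generated : ∀ i → Gen S (mem pieces i)
      piece-generated i = gen-meet _ λ
        { (lift true)  → gen-ideal (upper-ideal i)
        ; (lift false) → gen-orth (gen-ideal (lower-ideal i))
        }

    completelyJoinIrreducible-≐-member :
      ∀ {p} → CompletelyJoinIrreducibleInReg S p →
      (F : Family S) → (∀ i → RegClosed S (mem F i)) → p ≐ RegJoin S F →
      Σ (Idx F) λ i → mem F i ≐ p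
    completelyJoinIrreducible-≐-member {p} (_ , p* , (p*-reg , (_ , p⊈p*) , _) , _ , below⊆p*) F F-reg (p⊆⋁F , ⋁F⊆p)
      with em {Σ (Idx F) λ i → p ⊆ mem F i}
    ... | yes (i , p⊆Fi) = i , (λ Fia → ⋁F⊆p (⊆-regJoin F i Fia)) , p⊆Fi
    ... | no p⊈F = ⊥-elim (p⊈p* λ pa → regJoin-least p*-closed Fi⊆p* (p⊆⋁F pa))
      where
      p*-closed : Closed S p*
      p*-closed = joinClosed⇒closed (regClosed⇒joinClosed p*-reg)

      Fi⊆p* : ∀ i → mem F i ⊆ p*
      Fi⊆p* i = below⊆p* (mem F i) (F-reg i) ((λ Fia → ⋁F⊆p (⊆-regJoin F i Fia)) , λ p⊆Fi → p⊈F (i , p⊆Fi))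

    completelyJoinIrreducible⇒clopen : ∀ {p} → CompletelyJoinIrreducibleInReg S p → Clopen S p
    completelyJoinIrreducible⇒clopen p-cji@(p-reg , _) =
      let (F , F-clopen , p≐⋁F) = regClosed⇒regJoin-clopen p-reg
          (i , Fi≐p) = completelyJoinIrreducible-≐-member p-cji F (λ i → clopen⇒regClosed (F-clopen i)) p≐⋁F
      in clopen-cong Fi≐p (F-clopen i)

    clopenJoin⇒regJoin : ∀ F x → IsJoinIn S (Clopen S) F x → IsJoinIn S (RegClosed S) F x
    clopenJoin⇒regJoin F x (x-clopen , F⊆x , x-least) = clopen⇒regClosed x-clopen , F⊆x , x⊆u
      where
      x⊆u : ∀ u → RegClosed S u → (∀ i → mem F i ⊆ u) → x ⊆ u
      x⊆u u u-reg F⊆u with regClosed⇒regMeet-clopen u-reg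
      ... | G , G-clopen , (u⊆⋀G , ⋀G⊆u) = λ xa → ⋀G⊆u (open-⊆-regMeet (proj₂ x-clopen) x⊆G xa)
        where
        x⊆G : ∀ j → x ⊆ mem G j
        x⊆G j = x-least (mem G j) (G-clopen j) λ i Fia →
          regMeet-lowerBound (λ k → proj₁ (G-clopen k)) j (u⊆⋀G (F⊆u i Fia))

    clopenMeet⇒regMeet : ∀ F x → IsMeetIn S (Clopen S) F x → IsMeetIn S (RegClosed S) F x
    clopenMeet⇒regMeet F x (x-clopen , x⊆F , x-greatest) = clopen⇒regClosed x-clopen , x⊆F , u⊆x
      where
      u⊆x : ∀ u → RegClosed S u → (∀ i → u ⊆ mem F i) → u ⊆ x
      u⊆x u u-reg u⊆F with regClosed⇒regJoin-clopen u-reg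
      ... | H , H-clopen , (u⊆⋁H , ⋁H⊆u) = λ ua → regJoin-least (proj₁ x-clopen) H⊆x (u⊆⋁H ua)
        where
        H⊆x : ∀ j → mem H j ⊆ x
        H⊆x j = x-greatest (mem H j) (H-clopen j) λ i Hja → u⊆F i (⋁H⊆u (⊆-regJoin H j Hja))

corollary8p3 : {c ℓ₁ ℓ₂ : Level} (S : JoinSemilattice c ℓ₁ ℓ₂) →
    ExcludedMiddle (Lv S) →
    ((x : Subset S) → Open S x →
      (Σ (Set (Lv S)) λ I → Σ (I → Subset S) λ A → Σ (I → Subset S) λ B →
        ((i : I) → Ideal S (A i) × Ideal S (B i))
        × (x ≐ ⋃ S (fam I (λ i → A i ∖ B i))))
      × (Σ (Family S) λ F → AllClopen S F × (x ≐ ⋃ S F)))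
    × ((x : Subset S) → RegClosed S x → Σ (Subset S) λ y → Gen S y × (y ≐ x))
    × ((x : Subset S) → Clopen S x → RegClosed S x)
    × ((x : Subset S) → RegClosed S x →
        (Σ (Family S) λ F → AllClopen S F × (x ≐ RegJoin S F))
        × (Σ (Family S) λ F → AllClopen S F × (x ≐ RegMeet S F)))
    × ((p : Subset S) → CompletelyJoinIrreducibleInReg S p → Clopen S p)
    × ((F : Family S) → AllClopen S F → (x : Subset S) →
        (IsJoinIn S (Clopen S) F x → IsJoinIn S (RegClosed S) F x)
        × (IsMeetIn S (Clopen S) F x → IsMeetIn S (RegClosed S) F x))
corollary8p3 S em =
  (λ x x-open →
     let open IdealDifferenceCover (open⇒idealDifferenceCover x-open)
     in (Index , upper , lower , ideals , covers) , (_ , differences-clopen , covers)) ,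
  (λ x → regClosed⇒generated) ,
  (λ x → clopen⇒regClosed) ,
  (λ x x-reg → regClosed⇒regJoin-clopen x-reg , regClosed⇒regMeet-clopen x-reg) ,
  (λ p → completelyJoinIrreducible⇒clopen) ,
  -- (v) does not need the family itself to be clopen.
  (λ F _ x → clopenJoin⇒regJoin F x , clopenMeet⇒regMeet F x)
  where
  open φ-Closure S
  open Classical em
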